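{- Let $N$ be a normalized DNF with support size $k$ that is a weakening of $M_1=\bigvee_{j\in[n]\setminus\{1\}}x_{j,1}$ (i.e. $M_1$ implies $N$), and let $R$ be the set of total orders rejected by $N$. If $k\le n/10$, then there are at least $4|R|/5$ total orders accepted by more than one term of $N$.
   Context: Variables $x_{i,j}$, $i,j\in[n]$. A total order on $[n]$ is identified with the assignment $x_{i,j}=1$ iff $i$ precedes $j$; a formula accepts (rejects) a total order if this assignment satisfies (falsifies) it. For $T\subseteq[n]$, $|T|\ge2$, and a bijection $\pi:[|T|]\to T$, $[\![T]\!]_\pi$ is the term $x_{\pi(1),\pi(2)}\cdots x_{\pi(|T|-1),\pi(|T|)}$ (support $T$). A DNF is normalized if every term is of the form $[\![T]\!]_\pi$ for some $T$ containing $1$, and all terms have the same support size $|T|$ (the support size of the DNF). -}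

module Defs where

open import Data.Bool using (Bool; true; false; _∧_; _∨_; not)
open import Data.Nat using (ℕ; zero; suc; _≤ᵇ_)
open import Data.Fin using (Fin; _<?_; _≟_)
import Data.Fin as F
open import Data.Vec using (Vec; lookup; []; _∷_)
open import Data.List using (List; []; _∷_; [_]; map; concatMap; allFin; filterᵇ; length)
open import Data.Bool.ListAction using (all; any)
open import Data.List.Relation.Unary.Unique.Propositional using (Unique)
open import Data.List.Relation.Unary.All using (All)
open import Data.List.Membership.Propositional using (_∈_)
open import Data.Product using (_×_)
open import Relation.Binary.PropositionalEquality using (_≡_)
open import Relation.Nullary.Decidable using (⌊_⌋)

-- The ground set [n] is Fin n; the element "1" of [n] is Fin.zero.
-- A candidate order is a rank vector r : Vec (Fin n) n, where lookup r i
-- is the position of element i (position 0 = first).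
RankVec : ℕ → Set
RankVec n = Vec (Fin n) n

allVecs : (n m : ℕ) → List (Vec (Fin m) n)
allVecs zero    m = [ [] ]
allVecs (suc n) m = concatMap (λ v → map (λ a → a ∷ v) (allFin m)) (allVecs n m)

isInjᵇ : {n : ℕ} → RankVec n → Bool
isInjᵇ {n} r = all (λ i → all (λ j → ⌊ i ≟ j ⌋ ∨ not ⌊ lookup r i ≟ lookup r j ⌋) (allFin n)) (allFin n)

totalOrders : (n : ℕ) → List (RankVec n)
totalOrders n = filterᵇ isInjᵇ (allVecs n n)

x : {n : ℕ} → RankVec n → Fin n → Fin n → Bool
x r i j = ⌊ lookup r i <? lookup r j ⌋

-- A term [[T]]_π is represented by the list π(1), …, π(|T|);
-- its value is x_{π(1),π(2)} ∧ … ∧ x_{π(|T|-1),π(|T|)}.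
Term : ℕ → Set
Term n = List (Fin n)

evalTerm : {n : ℕ} → RankVec n → Term n → Bool
evalTerm r []            = true
evalTerm r (a ∷ [])      = true
evalTerm r (a ∷ b ∷ t)   = x r a b ∧ evalTerm r (b ∷ t)

DNF : ℕ → Set
DNF n = List (Term n)

evalDNF : {n : ℕ} → RankVec n → DNF n → Bool
evalDNF r N = any (evalTerm r) N

-- a term [[T]]_π with |T| = k and 1 ∈ T (π a bijection onto T: no repeats)
IsNormTerm : {n : ℕ} → ℕ → Term n → Set
IsNormTerm {suc m} k t = Unique t × length t ≡ k × F.zero ∈ t
IsNormTerm {zero}  k t = length t ≡ k

-- normalized DNF with support size k (terms require |T| ≥ 2)
IsNormalized : {n : ℕ} → ℕ → DNF n → Set
IsNormalized k N = (2 Data.Nat.≤ k) × Unique N × All (IsNormTerm k) N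

-- M_1 = ⋁_{j ∈ [n] \ {1}} x_{j,1}, for n = suc m (element 1 = zero,
-- the others are suc j for j : Fin m)
M1 : {m : ℕ} → RankVec (suc m) → Bool
M1 {m} r = any (λ j → x r (F.suc j) F.zero) (allFin m)

IsWeakeningOfM1 : {m : ℕ} → DNF (suc m) → Set
IsWeakeningOfM1 {m} N =
  (r : RankVec (suc m)) → r ∈ totalOrders (suc m) → M1 r ≡ true → evalDNF r N ≡ true

rejected : {n : ℕ} → DNF n → List (RankVec n)
rejected {n} N = filterᵇ (λ r → not (evalDNF r N)) (totalOrders n)

multiAccepted : {n : ℕ} → DNF n → List (RankVec n)
multiAccepted {n} N = filterᵇ (λ r → 2 ≤ᵇ length (filterᵇ (evalTerm r) N)) (totalOrders n)

{-# OPTIONS --safe #-}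
-- Let n = m + 1 and let σ be a rejected order. For each element b ≠ 1, moving b to the
-- front of σ satisfies M₁, hence some term τ_b (witness σ b) of N; since σ falsifies τ_b
-- and orders everything except b as the moved order does, b ∈ τ_b. As τ_b has k elements,
-- one of them 1, all but 2m(k − 1) of the m² pairs (b, c) are good: c ∉ τ_b and b ∉ τ_c.
-- For a good pair, moving b and then c to the front of σ yields an order satisfying the
-- distinct terms τ_b and τ_c, and this order together with the old positions of b and c
-- determines (σ, b, c). Hence |R| (m² − 2m(k − 1)) ≤ |multiAccepted N| n², and k ≤ n/10
-- turns this into 4 |R| ≤ 5 |multiAccepted N|.
module Submission where

open import Algebra.Properties.CommutativeSemigroup using (interchange)
open import Data.Bool using (true; false; T; not; _∧_; _∨_; if_then_else_)
open import Data.Bool.Properties using (T-≡; T-∨; T-not-≡)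
open import Data.Empty using (⊥-elim)
open import Data.Fin as Fin using (Fin; zero; suc; punchOut; _≟_)
open import Data.Fin.Properties
  using (punchOut-cong; punchOut-injective; punchOut-mono-≤; punchOut-cancel-≤; suc-injective)
open import Data.List
  using (List; []; _∷_; _++_; map; filter; filterᵇ; length; allFin; cartesianProduct;
         cartesianProductWith; concatMap)
open import Data.List.Properties using (length-++; length-map; length-tabulate; filter-++)
open import Data.List.Membership.Propositional using (_∈_; _∉_)
open import Data.List.Membership.Propositional.Properties
  using (∈-∃++; ∈-++⁻; ∈-++⁺ˡ; ∈-++⁺ʳ; ∈-filter⁺; ∈-filter⁻; ∈-map⁻; ∈-allFin;
         ∈-cartesianProduct⁺; ∈-cartesianProduct⁻; ∈-cartesianProductWith⁺)
import Data.List.Membership.DecPropositional as DecMembership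
open import Data.List.Relation.Binary.Subset.Propositional using (_⊆_)
open import Data.List.Relation.Unary.All as All using ([]; _∷_)
open import Data.List.Relation.Unary.All.Properties as All using (all⁺; all⁻)
open import Data.List.Relation.Unary.Any as Any using (here; there)
open import Data.List.Relation.Unary.Any.Properties as Any using (any⁺)
open import Data.List.Relation.Unary.AllPairs using ([]; _∷_)
open import Data.List.Relation.Unary.Unique.Propositional using (Unique)
import Data.List.Relation.Unary.Unique.Propositional.Properties as Unique
open import Data.Nat using (ℕ; zero; suc; _+_; _*_; _≤_; z≤n; s≤s)
open import Data.Nat.Properties
  using (+-suc; +-mono-≤; +-monoˡ-≤; +-monoʳ-≤; *-monoʳ-≤; *-comm; *-assoc; +-cancelʳ-≤; *-cancelʳ-≤;
         ≤-trans; ≤-pred; ≰⇒>; <⇒≱; <-irrefl; ≤⇒≤ᵇ; m≤m+n; m≤n+m; +-commutativeSemigroup;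
         module ≤-Reasoning)
open import Data.Nat.Tactic.RingSolver using (solve-∀)
open import Data.Product using (_×_; _,_; proj₁; proj₂; swap)
open import Data.Sum using (inj₁; inj₂)
open import Data.Vec as Vec using (Vec; lookup; []; _∷_)
open import Data.Vec.Properties using (lookup-map; ∷-injectiveˡ; ∷-injectiveʳ)
open import Data.Vec.Relation.Binary.Pointwise.Extensional using (ext; Pointwise-≡⇒≡)
open import Function using (_∘_; _⇔_; mk⇔; Equivalence)
open import Function.Definitions using (Injective)
open import Level using (0ℓ)
open import Relation.Binary.PropositionalEquality
open import Relation.Nullary using (Dec; yes; no; ¬?; _×-dec_)
open import Relation.Nullary.Decidable
  using (T?; ⌊_⌋; does-⇔; isYes≗does; toWitness; toWitnessFalse; fromWitnessFalse)
open import Relation.Unary using (Pred; Decidable)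

open import Defs

private variable
  A B C : Set

-- Counting lists

injectiveOn⇒length≤ : ∀ (f : A → B) {xs ys} → Unique xs →
  (∀ {x} → x ∈ xs → f x ∈ ys) →
  (∀ {x y} → x ∈ xs → y ∈ xs → f x ≡ f y → x ≡ y) →
  length xs ≤ length ys
injectiveOn⇒length≤ f {[]}     _                   _         _           = z≤n
injectiveOn⇒length≤ f {x ∷ xs} (x≢xs ∷ xs-unique) maps-into injective-on
  with ys₁ , ys₂ , refl ← ∈-∃++ (maps-into (here refl)) = begin
    suc (length xs)                  ≤⟨ s≤s (injectiveOn⇒length≤ f xs-unique maps-into′ injective-on′) ⟩
    suc (length (ys₁ ++ ys₂))        ≡⟨ cong suc (length-++ ys₁) ⟩
    suc (length ys₁ + length ys₂)    ≡⟨ +-suc (length ys₁) (length ys₂) ⟨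
    length ys₁ + length (f x ∷ ys₂) ≡⟨ length-++ ys₁ ⟨
    length (ys₁ ++ f x ∷ ys₂)       ∎
  where
  open ≤-Reasoning
  maps-into′ : ∀ {y} → y ∈ xs → f y ∈ ys₁ ++ ys₂
  maps-into′ y∈xs with ∈-++⁻ ys₁ (maps-into (there y∈xs))
  ... | inj₁ fy∈ys₁         = ∈-++⁺ˡ fy∈ys₁
  ... | inj₂ (here fy≡fx)   =
    ⊥-elim (All.lookup x≢xs y∈xs (sym (injective-on (there y∈xs) (here refl) fy≡fx)))
  ... | inj₂ (there fy∈ys₂) = ∈-++⁺ʳ ys₁ fy∈ys₂
  injective-on′ : ∀ {y z} → y ∈ xs → z ∈ xs → f y ≡ f z → y ≡ z
  injective-on′ y∈xs z∈xs = injective-on (there y∈xs) (there z∈xs)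

Unique∧⊆⇒length≤ : {xs ys : List A} → Unique xs → xs ⊆ ys → length xs ≤ length ys
Unique∧⊆⇒length≤ xs-unique xs⊆ys = injectiveOn⇒length≤ (λ x → x) xs-unique xs⊆ys (λ _ _ eq → eq)

length-cartesianProduct : (xs : List A) (ys : List B) →
  length (cartesianProduct xs ys) ≡ length xs * length ys
length-cartesianProduct []       ys = refl
length-cartesianProduct (x ∷ xs) ys = begin
  length (map (x ,_) ys ++ cartesianProduct xs ys)         ≡⟨ length-++ (map (x ,_) ys) ⟩
  length (map (x ,_) ys) + length (cartesianProduct xs ys) ≡⟨ cong₂ _+_ (length-map (x ,_) ys)
                                                                        (length-cartesianProduct xs ys) ⟩
  length ys + length xs * length ys                        ∎
  where open ≡-Reasoning

length-allFin : ∀ n → length (allFin n) ≡ n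
length-allFin n = length-tabulate {n = n} (λ i → i)

length-allFin² : ∀ n → length (cartesianProduct (allFin n) (allFin n)) ≡ n * n
length-allFin² n =
  trans (length-cartesianProduct (allFin n) (allFin n)) (cong₂ _*_ (length-allFin n) (length-allFin n))

concatMap-map≡cartesianProductWith : ∀ (f : A → B → C) xs ys →
  concatMap (λ x → map (f x) ys) xs ≡ cartesianProductWith f xs ys
concatMap-map≡cartesianProductWith f []       ys = refl
concatMap-map≡cartesianProductWith f (x ∷ xs) ys =
  cong (map (f x) ys ++_) (concatMap-map≡cartesianProductWith f xs ys)

module _ {P : Pred (A × B) 0ℓ} (P? : Decidable P) where

  fibre : A → List B → List B
  fibre x = filter (λ y → P? (x , y))

  length-filter-cartesianProduct-∷ : ∀ x xs ys →
    length (filter P? (cartesianProduct (x ∷ xs) ys)) ≡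
    length (fibre x ys) + length (filter P? (cartesianProduct xs ys))
  length-filter-cartesianProduct-∷ x xs ys = begin
    length (filter P? (map (x ,_) ys ++ cartesianProduct xs ys))
      ≡⟨ cong length (filter-++ P? (map (x ,_) ys) _) ⟩
    length (filter P? (map (x ,_) ys) ++ filter P? (cartesianProduct xs ys))
      ≡⟨ length-++ (filter P? (map (x ,_) ys)) ⟩
    length (filter P? (map (x ,_) ys)) + length (filter P? (cartesianProduct xs ys))
      ≡⟨ cong (_+ _) (length-filter-map-, ys) ⟩
    length (fibre x ys) + length (filter P? (cartesianProduct xs ys)) ∎
    where
    open ≡-Reasoning
    length-filter-map-, : ∀ ys → length (filter P? (map (x ,_) ys)) ≡ length (fibre x ys)
    length-filter-map-, []       = refl
    length-filter-map-, (y ∷ ys) with P? (x , y)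
    ... | yes _ = cong suc (length-filter-map-, ys)
    ... | no  _ = length-filter-map-, ys

  length-filter-cartesianProduct-≤ : ∀ xs ys K →
    (∀ {x} → x ∈ xs → length (fibre x ys) ≤ K) →
    length (filter P? (cartesianProduct xs ys)) ≤ length xs * K
  length-filter-cartesianProduct-≤ []       ys K fibres≤ = z≤n
  length-filter-cartesianProduct-≤ (x ∷ xs) ys K fibres≤ = begin
    length (filter P? (cartesianProduct (x ∷ xs) ys))
      ≡⟨ length-filter-cartesianProduct-∷ x xs ys ⟩
    length (fibre x ys) + length (filter P? (cartesianProduct xs ys))
      ≤⟨ +-mono-≤ (fibres≤ (here refl)) (length-filter-cartesianProduct-≤ xs ys K (fibres≤ ∘ there)) ⟩
    K + length xs * K ∎
    where open ≤-Reasoning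

  -- Each fibre has at least a − c elements; stated without truncated subtraction.
  length-filter-cartesianProduct-≥ : ∀ xs ys a c →
    (∀ {x} → x ∈ xs → a ≤ length (fibre x ys) + c) →
    length xs * a ≤ length (filter P? (cartesianProduct xs ys)) + length xs * c
  length-filter-cartesianProduct-≥ []       ys a c fibres≥ = z≤n
  length-filter-cartesianProduct-≥ (x ∷ xs) ys a c fibres≥ = begin
    a + length xs * a
      ≤⟨ +-mono-≤ (fibres≥ (here refl)) (length-filter-cartesianProduct-≥ xs ys a c (fibres≥ ∘ there)) ⟩
    (length (fibre x ys) + c) + (length (filter P? (cartesianProduct xs ys)) + length xs * c)
      ≡⟨ interchange +-commutativeSemigroup (length (fibre x ys)) c _ (length xs * c) ⟩
    (length (fibre x ys) + length (filter P? (cartesianProduct xs ys))) + (c + length xs * c)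
      ≡⟨ cong (_+ _) (length-filter-cartesianProduct-∷ x xs ys) ⟨
    length (filter P? (cartesianProduct (x ∷ xs) ys)) + length (x ∷ xs) * c ∎
    where open ≤-Reasoning

IsTotalOrder : {n : ℕ} → RankVec n → Set
IsTotalOrder r = Injective _≡_ _≡_ (lookup r)

module _ {m : ℕ} where

  ∈-allVecs : ∀ {n} (v : Vec (Fin m) n) → v ∈ allVecs n m
  ∈-allVecs []              = here refl
  ∈-allVecs {suc n} (a ∷ v) =
    subst (a ∷ v ∈_) (sym (concatMap-map≡cartesianProductWith (λ v a → a ∷ v) (allVecs n m) (allFin m)))
      (∈-cartesianProductWith⁺ (λ v a → a ∷ v) (∈-allVecs v) (∈-allFin a))

  allVecs-unique : ∀ n → Unique (allVecs n m)
  allVecs-unique zero    = [] ∷ []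
  allVecs-unique (suc n) =
    subst Unique (sym (concatMap-map≡cartesianProductWith (λ v a → a ∷ v) (allVecs n m) (allFin m)))
      (Unique.cartesianProductWith⁺ (λ v a → a ∷ v) (λ eq → ∷-injectiveʳ eq , ∷-injectiveˡ eq)
        (allVecs-unique n) (Unique.allFin⁺ m))

module _ {n : ℕ} {r : RankVec n} where

  isInjᵇ⇒IsTotalOrder : T (isInjᵇ r) → IsTotalOrder r
  isInjᵇ⇒IsTotalOrder inj {i} {j} ri≡rj
    with Equivalence.to (T-∨ {⌊ i ≟ j ⌋})
           (All.tabulate⁻ (all⁺ _ (allFin n) (All.tabulate⁻ (all⁺ _ (allFin n) inj) i)) j)
  ... | inj₁ i≡j   = toWitness {a? = i ≟ j} i≡j
  ... | inj₂ ri≢rj = ⊥-elim (toWitnessFalse {a? = lookup r i ≟ lookup r j} ri≢rj ri≡rj)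

  IsTotalOrder⇒isInjᵇ : IsTotalOrder r → T (isInjᵇ r)
  IsTotalOrder⇒isInjᵇ r-order = all⁻ _ (All.tabulate⁺ λ i → all⁻ _ (All.tabulate⁺ λ j → distinct i j))
    where
    distinct : ∀ i j → T (⌊ i ≟ j ⌋ ∨ not ⌊ lookup r i ≟ lookup r j ⌋)
    distinct i j with i ≟ j
    ... | yes _  = _
    ... | no i≢j = fromWitnessFalse (i≢j ∘ r-order)

  ∈-totalOrders⁺ : IsTotalOrder r → r ∈ totalOrders n
  ∈-totalOrders⁺ r-order = ∈-filter⁺ (T? ∘ isInjᵇ) (∈-allVecs r) (IsTotalOrder⇒isInjᵇ r-order)

  ∈-totalOrders⁻ : r ∈ totalOrders n → IsTotalOrder r
  ∈-totalOrders⁻ r∈ = isInjᵇ⇒IsTotalOrder (proj₂ (∈-filter⁻ (T? ∘ isInjᵇ) {xs = allVecs n n} r∈))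

totalOrders-unique : ∀ n → Unique (totalOrders n)
totalOrders-unique n = Unique.filter⁺ (T? ∘ isInjᵇ) (allVecs-unique n)

-- Moving an element to the front

toFront : ∀ {m} → Fin (suc m) → Fin (suc m) → Fin (suc m)
toFront p t with t ≟ p
... | yes _  = zero
... | no t≢p = suc (punchOut (t≢p ∘ sym))

module _ {m : ℕ} where

  toFront-self : ∀ (p : Fin (suc m)) → toFront p p ≡ zero
  toFront-self p with p ≟ p
  ... | yes _  = refl
  ... | no p≢p = ⊥-elim (p≢p refl)

  toFront-≢ : ∀ {p t : Fin (suc m)} (t≢p : t ≢ p) → toFront p t ≡ suc (punchOut (t≢p ∘ sym))
  toFront-≢ {p} {t} t≢p with t ≟ p
  ... | yes t≡p = ⊥-elim (t≢p t≡p)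
  ... | no _    = cong suc (punchOut-cong p refl)

  toFront-injective : ∀ (p : Fin (suc m)) → Injective _≡_ _≡_ (toFront p)
  toFront-injective p {t} {u} eq with t ≟ p | u ≟ p
  ... | yes t≡p | yes u≡p = trans t≡p (sym u≡p)
  ... | no t≢p  | no u≢p  = punchOut-injective (t≢p ∘ sym) (u≢p ∘ sym) (suc-injective eq)

  toFront-<-⇔ : ∀ {p t u : Fin (suc m)} (t≢p : t ≢ p) (u≢p : u ≢ p) →
    (toFront p t Fin.< toFront p u) ⇔ (t Fin.< u)
  toFront-<-⇔ t≢p u≢p rewrite toFront-≢ t≢p | toFront-≢ u≢p = mk⇔ reflect preserve
    where
    p≢t = t≢p ∘ sym
    p≢u = u≢p ∘ sym
    reflect : suc (punchOut p≢t) Fin.< suc (punchOut p≢u) → _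
    reflect (s≤s pt<pu) = ≰⇒> (λ u≤t → <⇒≱ pt<pu (punchOut-mono-≤ p≢u p≢t u≤t))
    preserve : _ → suc (punchOut p≢t) Fin.< suc (punchOut p≢u)
    preserve t<u = s≤s (≰⇒> (λ pu≤pt → <⇒≱ t<u (punchOut-cancel-≤ p≢u p≢t pu≤pt)))

toFront-zero : ∀ {m} {p q : Fin (suc m)} → p ≢ zero → q ≢ zero → toFront p zero ≡ toFront q zero
toFront-zero {p = zero}                   p≢0 _   = ⊥-elim (p≢0 refl)
toFront-zero {p = suc _} {zero}           _   q≢0 = ⊥-elim (q≢0 refl)
toFront-zero {suc _}     {suc _} {suc _}  _   _   = refl

moveToFront : ∀ {m} → RankVec (suc m) → Fin (suc m) → RankVec (suc m)
moveToFront r a = Vec.map (toFront (lookup r a)) r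

isYes-⇔ : ∀ {P Q : Set} → P ⇔ Q → (p? : Dec P) (q? : Dec Q) → ⌊ p? ⌋ ≡ ⌊ q? ⌋
isYes-⇔ P⇔Q p? q? = trans (isYes≗does p?) (trans (does-⇔ P⇔Q p? q?) (sym (isYes≗does q?)))

module _ {m : ℕ} (r : RankVec (suc m)) where

  lookup-moveToFront : ∀ a u → lookup (moveToFront r a) u ≡ toFront (lookup r a) (lookup r u)
  lookup-moveToFront a u = lookup-map u (toFront (lookup r a)) r

  moveToFront-first : ∀ a → lookup (moveToFront r a) a ≡ zero
  moveToFront-first a = trans (lookup-moveToFront a a) (toFront-self (lookup r a))

  moveToFront-isTotalOrder : ∀ a → IsTotalOrder r → IsTotalOrder (moveToFront r a)
  moveToFront-isTotalOrder a r-order {u} {v} eq = r-order (toFront-injective (lookup r a)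
    (trans (sym (lookup-moveToFront a u)) (trans eq (lookup-moveToFront a v))))

  x-irrefl : ∀ u → x r u u ≡ false
  x-irrefl u with lookup r u Fin.<? lookup r u
  ... | yes lt = ⊥-elim (<-irrefl refl lt)
  ... | no _   = refl

  x-moveToFront-≢ : ∀ {a u v} → IsTotalOrder r → u ≢ a → v ≢ a → x (moveToFront r a) u v ≡ x r u v
  x-moveToFront-≢ {a} {u} {v} r-order u≢a v≢a rewrite lookup-moveToFront a u | lookup-moveToFront a v =
    isYes-⇔ (toFront-<-⇔ (u≢a ∘ r-order) (v≢a ∘ r-order)) _ _

  x-moveToFront-first : ∀ {a v} → IsTotalOrder r → v ≢ a → x (moveToFront r a) a v ≡ true
  x-moveToFront-first {a} {v} r-order v≢a
    rewrite moveToFront-first a | lookup-moveToFront a v | toFront-≢ {p = lookup r a} (v≢a ∘ r-order) = refl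

  x-moveToFront-last : ∀ a u → x (moveToFront r a) u a ≡ false
  x-moveToFront-last a u rewrite moveToFront-first a = refl

moveToFront-cancel : ∀ {m} {r r′ : RankVec (suc m)} a → lookup r a ≡ lookup r′ a →
  moveToFront r a ≡ moveToFront r′ a → r ≡ r′
moveToFront-cancel {r = r} {r′} a same-a eq = Pointwise-≡⇒≡ (ext λ u →
  toFront-injective (lookup r a) (begin
    toFront (lookup r a) (lookup r u)   ≡⟨ lookup-moveToFront r a u ⟨
    lookup (moveToFront r a) u          ≡⟨ cong (λ s → lookup s u) eq ⟩
    lookup (moveToFront r′ a) u         ≡⟨ lookup-moveToFront r′ a u ⟩
    toFront (lookup r′ a) (lookup r′ u) ≡⟨ cong (λ p → toFront p (lookup r′ u)) same-a ⟨
    toFront (lookup r a) (lookup r′ u)  ∎))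
  where open ≡-Reasoning

AgreeOn : {n : ℕ} → Pred (Fin n) 0ℓ → RankVec n → RankVec n → Set
AgreeOn P r r′ = ∀ {u v} → P u → P v → x r u v ≡ x r′ u v

evalTerm-cong : ∀ {n} {r r′ : RankVec n} (t : Term n) → AgreeOn (_∈ t) r r′ → evalTerm r t ≡ evalTerm r′ t
evalTerm-cong []          agree = refl
evalTerm-cong (a ∷ [])    agree = refl
evalTerm-cong (a ∷ b ∷ t) agree = cong₂ _∧_ (agree (here refl) (there (here refl)))
                                             (evalTerm-cong (b ∷ t) (λ u∈ v∈ → agree (there u∈) (there v∈)))

module _ {m : ℕ} where

  moveToFront-agreeOn : ∀ {P} (r r′ : RankVec (suc m)) a → IsTotalOrder r → IsTotalOrder r′ →
    AgreeOn P r r′ → AgreeOn P (moveToFront r a) (moveToFront r′ a)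
  moveToFront-agreeOn r r′ a r-order r′-order agree {u} {v} Pu Pv with u ≟ a | v ≟ a
  ... | yes refl | yes refl = trans (x-irrefl (moveToFront r a) a) (sym (x-irrefl (moveToFront r′ a) a))
  ... | yes refl | no v≢a   = trans (x-moveToFront-first r r-order v≢a) (sym (x-moveToFront-first r′ r′-order v≢a))
  ... | no u≢a   | yes refl = trans (x-moveToFront-last r a u) (sym (x-moveToFront-last r′ a u))
  ... | no u≢a   | no v≢a   = begin
    x (moveToFront r a) u v   ≡⟨ x-moveToFront-≢ r r-order u≢a v≢a ⟩
    x r u v                   ≡⟨ agree Pu Pv ⟩
    x r′ u v                  ≡⟨ x-moveToFront-≢ r′ r′-order u≢a v≢a ⟨
    x (moveToFront r′ a) u v  ∎
    where open ≡-Reasoning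

  evalTerm-moveToFront-∉ : ∀ (r : RankVec (suc m)) {a} t → IsTotalOrder r → a ∉ t →
    evalTerm (moveToFront r a) t ≡ evalTerm r t
  evalTerm-moveToFront-∉ r t r-order a∉t =
    evalTerm-cong t λ u∈t v∈t →
      x-moveToFront-≢ r r-order (λ { refl → a∉t u∈t }) (λ { refl → a∉t v∈t })

  M1-moveToFront : ∀ (r : RankVec (suc m)) b → IsTotalOrder r → M1 (moveToFront r (suc b)) ≡ true
  M1-moveToFront r b r-order =
    Equivalence.to T-≡ (any⁺ _ (Any.tabulate⁺ b (Equivalence.from T-≡ (x-moveToFront-first r r-order λ ()))))

module _ {m : ℕ} where

  open DecMembership (_≟_ {suc m}) using (_∈?_)

  sucMembers : List (Fin (suc m)) → List (Fin m)
  sucMembers t = filter (λ c → suc c ∈? t) (allFin m)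

  length-sucMembers<length : ∀ {t} → Unique t → zero ∈ t → suc (length (sucMembers t)) ≤ length t
  length-sucMembers<length {t} t-unique zero∈t = begin
    suc (length (sucMembers t))            ≡⟨ cong suc (length-map suc (sucMembers t)) ⟨
    length (zero ∷ map suc (sucMembers t)) ≤⟨ Unique∧⊆⇒length≤ unique ⊆t ⟩
    length t                               ∎
    where
    open ≤-Reasoning
    unique : Unique (zero ∷ map suc (sucMembers t))
    unique = All.map⁺ (All.universal (λ _ ()) (sucMembers t))
           ∷ Unique.map⁺ suc-injective (Unique.filter⁺ _ (Unique.allFin⁺ m))
    ⊆t : zero ∷ map suc (sucMembers t) ⊆ t
    ⊆t (here refl) = zero∈t
    ⊆t (there u∈)  with c , c∈ , refl ← ∈-map⁻ suc u∈ =
      proj₂ (∈-filter⁻ (λ c → suc c ∈? t) {xs = allFin m} c∈)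

firstAccepted : ∀ {n} → RankVec n → DNF n → Term n
firstAccepted r []      = []
firstAccepted r (t ∷ N) = if evalTerm r t then t else firstAccepted r N

module _ {n : ℕ} where

  firstAccepted-accepted : ∀ (r : RankVec n) N → T (evalDNF r N) →
    firstAccepted r N ∈ N × T (evalTerm r (firstAccepted r N))
  firstAccepted-accepted r (t ∷ N) acc with evalTerm r t in eq
  ... | true  = here refl , Equivalence.from T-≡ eq
  ... | false = let t′∈N , t′-acc = firstAccepted-accepted r N acc in there t′∈N , t′-acc

  evalDNF-accepts : ∀ {r : RankVec n} {N t} → t ∈ N → T (evalTerm r t) → T (evalDNF r N)
  evalDNF-accepts t∈N acc = any⁺ _ (Any.map (λ { refl → acc }) t∈N)

  ∈-rejected⁻ : ∀ (N : DNF n) {r} → r ∈ rejected N → IsTotalOrder r × evalDNF r N ≡ false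
  ∈-rejected⁻ N r∈R
    with r∈TO , rej ← ∈-filter⁻ (T? ∘ λ r → not (evalDNF r N)) {xs = totalOrders n} r∈R =
    ∈-totalOrders⁻ r∈TO , Equivalence.to T-not-≡ rej

  rejected-unique : ∀ (N : DNF n) → Unique (rejected N)
  rejected-unique N = Unique.filter⁺ _ (totalOrders-unique n)

  ∈-multiAccepted⁺ : ∀ {N : DNF n} {r t t′} → IsTotalOrder r → t ∈ N → t′ ∈ N → t ≢ t′ →
    T (evalTerm r t) → T (evalTerm r t′) → r ∈ multiAccepted N
  ∈-multiAccepted⁺ {N} {r} {t} {t′} r-order t∈N t′∈N t≢t′ t-acc t′-acc =
    ∈-filter⁺ _ (∈-totalOrders⁺ r-order) (≤⇒≤ᵇ (Unique∧⊆⇒length≤ ((t≢t′ ∷ []) ∷ [] ∷ []) both∈))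
    where
    both∈ : t ∷ t′ ∷ [] ⊆ filterᵇ (evalTerm r) N
    both∈ (here refl)         = ∈-filter⁺ (T? ∘ evalTerm r) t∈N t-acc
    both∈ (there (here refl)) = ∈-filter⁺ (T? ∘ evalTerm r) t′∈N t′-acc

-- The double counting

module Counting {m k′ : ℕ} (N : DNF (suc m)) (N-normal : IsNormalized (suc k′) N)
                (N-weakens : IsWeakeningOfM1 N) where

  open DecMembership (_≟_ {suc m}) using (_∈?_)

  front : RankVec (suc m) → Fin m → RankVec (suc m)
  front σ b = moveToFront σ (suc b)

  front² : RankVec (suc m) → Fin m → Fin m → RankVec (suc m)
  front² σ b c = moveToFront (front σ b) (suc c)

  witness : RankVec (suc m) → Fin m → Term (suc m)
  witness σ b = firstAccepted (front σ b) N

  Good : RankVec (suc m) → Pred (Fin m × Fin m) 0ℓ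
  Good σ (b , c) = suc c ∉ witness σ b × suc b ∉ witness σ c

  good? : ∀ σ → Decidable (Good σ)
  good? σ (b , c) = ¬? (suc c ∈? witness σ b) ×-dec ¬? (suc b ∈? witness σ c)

  pairs : List (Fin m × Fin m)
  pairs = cartesianProduct (allFin m) (allFin m)

  pairs-unique : Unique pairs
  pairs-unique = Unique.cartesianProduct⁺ (Unique.allFin⁺ m) (Unique.allFin⁺ m)

  module Rejected {σ : RankVec (suc m)} (σ∈R : σ ∈ rejected N) where

    σ-order : IsTotalOrder σ
    σ-order = proj₁ (∈-rejected⁻ N σ∈R)

    front-order : ∀ b → IsTotalOrder (front σ b)
    front-order b = moveToFront-isTotalOrder σ (suc b) σ-order

    front²-order : ∀ b c → IsTotalOrder (front² σ b c)
    front²-order b c = moveToFront-isTotalOrder (front σ b) (suc c) (front-order b)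

    witness-∈×accepted : ∀ b → witness σ b ∈ N × T (evalTerm (front σ b) (witness σ b))
    witness-∈×accepted b = firstAccepted-accepted (front σ b) N (Equivalence.from T-≡
      (N-weakens (front σ b) (∈-totalOrders⁺ (front-order b)) (M1-moveToFront σ b σ-order)))

    witness-∈ : ∀ b → witness σ b ∈ N
    witness-∈ b = proj₁ (witness-∈×accepted b)

    witness-accepted : ∀ b → T (evalTerm (front σ b) (witness σ b))
    witness-accepted b = proj₂ (witness-∈×accepted b)

    suc∈witness : ∀ b → suc b ∈ witness σ b
    suc∈witness b with suc b ∈? witness σ b
    ... | yes ∈w = ∈w
    ... | no ∉w  = ⊥-elim (subst T (proj₂ (∈-rejected⁻ N σ∈R)) (evalDNF-accepts (witness-∈ b)
                     (subst T (evalTerm-moveToFront-∉ σ (witness σ b) σ-order ∉w) (witness-accepted b))))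

    length-sucMembers-witness : ∀ b → length (sucMembers (witness σ b)) ≤ k′
    length-sucMembers-witness b
      with w-unique , w-length , zero∈w ← All.lookup (proj₂ (proj₂ N-normal)) (witness-∈ b) =
      ≤-pred (subst (suc (length (sucMembers (witness σ b))) ≤_) w-length
                    (length-sucMembers<length w-unique zero∈w))

    Overlap : Pred (Fin m × Fin m) 0ℓ
    Overlap (b , c) = suc c ∈ witness σ b

    overlap? : Decidable Overlap
    overlap? (b , c) = suc c ∈? witness σ b

    overlap-swap? : Decidable (Overlap ∘ swap)
    overlap-swap? = overlap? ∘ swap

    length-overlaps : length (filter overlap? pairs) ≤ m * k′
    length-overlaps = subst (λ l → length (filter overlap? pairs) ≤ l * k′) (length-allFin m)
      (length-filter-cartesianProduct-≤ overlap? (allFin m) (allFin m) k′ (λ {b} _ → length-sucMembers-witness b))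

    length-swapped-overlaps : length (filter overlap-swap? pairs) ≤ length (filter overlap? pairs)
    length-swapped-overlaps = injectiveOn⇒length≤ swap (Unique.filter⁺ overlap-swap? pairs-unique)
      (λ bc∈ → ∈-filter⁺ overlap? (∈-cartesianProduct⁺ (∈-allFin _) (∈-allFin _))
                                  (proj₂ (∈-filter⁻ overlap-swap? {xs = pairs} bc∈)))
      (λ { {_ , _} {_ , _} _ _ refl → refl })

    pairs-⊆ : pairs ⊆ filter (good? σ) pairs ++ filter overlap? pairs ++ filter overlap-swap? pairs
    pairs-⊆ {b , c} bc∈ with suc c ∈? witness σ b | suc b ∈? witness σ c
    ... | yes c∈wb | _        = ∈-++⁺ʳ (filter (good? σ) pairs) (∈-++⁺ˡ (∈-filter⁺ overlap? bc∈ c∈wb))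
    ... | no c∉wb  | yes b∈wc = ∈-++⁺ʳ (filter (good? σ) pairs)
                                  (∈-++⁺ʳ (filter overlap? pairs) (∈-filter⁺ overlap-swap? bc∈ b∈wc))
    ... | no c∉wb  | no b∉wc  = ∈-++⁺ˡ (∈-filter⁺ (good? σ) bc∈ (c∉wb , b∉wc))

    length-good-pairs : m * m ≤ length (filter (good? σ) pairs) + (m * k′ + m * k′)
    length-good-pairs = begin
      m * m        ≡⟨ length-allFin² m ⟨
      length pairs ≤⟨ Unique∧⊆⇒length≤ pairs-unique pairs-⊆ ⟩
      length (goods ++ overlaps ++ swapped)            ≡⟨ length-++ goods ⟩
      length goods + length (overlaps ++ swapped)      ≡⟨ cong (length goods +_) (length-++ overlaps) ⟩
      length goods + (length overlaps + length swapped)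
        ≤⟨ +-monoʳ-≤ (length goods)
                     (+-mono-≤ length-overlaps (≤-trans length-swapped-overlaps length-overlaps)) ⟩
      length goods + (m * k′ + m * k′) ∎
      where
      open ≤-Reasoning
      goods    = filter (good? σ) pairs
      overlaps = filter overlap? pairs
      swapped  = filter overlap-swap? pairs

    module GoodPair {b c : Fin m} (good : Good σ (b , c)) where

      accepts-witness-b : T (evalTerm (front² σ b c) (witness σ b))
      accepts-witness-b = subst T
        (sym (evalTerm-moveToFront-∉ (front σ b) (witness σ b) (front-order b) (proj₁ good)))
        (witness-accepted b)

      -- front² σ b c and front σ c only disagree about b, which is not in witness σ c.
      accepts-witness-c : T (evalTerm (front² σ b c) (witness σ c))
      accepts-witness-c = subst T (sym (evalTerm-cong (witness σ c) agree)) (witness-accepted c)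
        where
        ≢b : ∀ {u} → u ∈ witness σ c → u ≢ suc b
        ≢b u∈ refl = proj₂ good u∈
        agree : AgreeOn (_∈ witness σ c) (front² σ b c) (front σ c)
        agree = moveToFront-agreeOn (front σ b) σ (suc c) (front-order b) σ-order
                  (λ u∈ v∈ → x-moveToFront-≢ σ σ-order (≢b u∈) (≢b v∈))

      front²-∈-multiAccepted : front² σ b c ∈ multiAccepted N
      front²-∈-multiAccepted = ∈-multiAccepted⁺ (front²-order b c) (witness-∈ b) (witness-∈ c)
        (λ eq → proj₂ good (subst (suc b ∈_) eq (suc∈witness b))) accepts-witness-b accepts-witness-c

      front-position-c≢0 : lookup (front σ b) (suc c) ≢ zero
      front-position-c≢0 eq = proj₁ good (subst (_∈ witness σ b) b≡c (suc∈witness b))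
        where
        b≡c : suc b ≡ suc c
        b≡c = front-order b (trans (moveToFront-first σ (suc b)) (sym eq))

      front²-position-b : lookup (front² σ b c) (suc b) ≡ toFront (lookup (front σ b) (suc c)) zero
      front²-position-b = trans (lookup-moveToFront (front σ b) (suc c) (suc b))
        (cong (toFront (lookup (front σ b) (suc c))) (moveToFront-first σ (suc b)))

  front²-cancel : ∀ {σ σ′ b c} → lookup σ (suc b) ≡ lookup σ′ (suc b) →
    lookup σ (suc c) ≡ lookup σ′ (suc c) → front² σ b c ≡ front² σ′ b c → σ ≡ σ′
  front²-cancel {σ} {σ′} {b} {c} same-b same-c eq =
    moveToFront-cancel (suc b) same-b (moveToFront-cancel (suc c) same-front-c eq)
    where
    open ≡-Reasoning
    same-front-c : lookup (front σ b) (suc c) ≡ lookup (front σ′ b) (suc c)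
    same-front-c = begin
      lookup (front σ b) (suc c)                      ≡⟨ lookup-moveToFront σ (suc b) (suc c) ⟩
      toFront (lookup σ (suc b)) (lookup σ (suc c))   ≡⟨ cong₂ toFront same-b same-c ⟩
      toFront (lookup σ′ (suc b)) (lookup σ′ (suc c)) ≡⟨ lookup-moveToFront σ′ (suc b) (suc c) ⟨
      lookup (front σ′ b) (suc c)                     ∎

  front²-determines-c : ∀ {σ₁ σ₂ b₁ b₂ c₁ c₂} → σ₁ ∈ rejected N →
    front² σ₁ b₁ c₁ ≡ front² σ₂ b₂ c₂ → c₁ ≡ c₂
  front²-determines-c {σ₁} {σ₂} {b₁} {b₂} {c₁} {c₂} σ₁∈R eq =
    suc-injective (Rejected.front²-order σ₁∈R b₁ c₁ (begin
      lookup (front² σ₁ b₁ c₁) (suc c₁) ≡⟨ moveToFront-first (front σ₁ b₁) (suc c₁) ⟩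
      zero                              ≡⟨ moveToFront-first (front σ₂ b₂) (suc c₂) ⟨
      lookup (front² σ₂ b₂ c₂) (suc c₂) ≡⟨ cong (λ r → lookup r (suc c₂)) eq ⟨
      lookup (front² σ₁ b₁ c₁) (suc c₂) ∎))
    where open ≡-Reasoning

  -- b comes right after c in front² σ b c.
  front²-determines-b : ∀ {σ₁ σ₂ b₁ b₂ c} → σ₁ ∈ rejected N → Good σ₁ (b₁ , c) →
    σ₂ ∈ rejected N → Good σ₂ (b₂ , c) → front² σ₁ b₁ c ≡ front² σ₂ b₂ c → b₁ ≡ b₂
  front²-determines-b {σ₁} {σ₂} {b₁} {b₂} {c} σ₁∈R good₁ σ₂∈R good₂ eq =
    suc-injective (Rejected.front²-order σ₁∈R b₁ c (begin
      lookup (front² σ₁ b₁ c) (suc b₁)            ≡⟨ Good₁.front²-position-b ⟩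
      toFront (lookup (front σ₁ b₁) (suc c)) zero
        ≡⟨ toFront-zero Good₁.front-position-c≢0 Good₂.front-position-c≢0 ⟩
      toFront (lookup (front σ₂ b₂) (suc c)) zero ≡⟨ Good₂.front²-position-b ⟨
      lookup (front² σ₂ b₂ c) (suc b₂)            ≡⟨ cong (λ r → lookup r (suc b₂)) eq ⟨
      lookup (front² σ₁ b₁ c) (suc b₂)            ∎))
    where
    open ≡-Reasoning
    module Good₁ = Rejected.GoodPair σ₁∈R good₁
    module Good₂ = Rejected.GoodPair σ₂∈R good₂

  Triple : Set
  Triple = RankVec (suc m) × (Fin m × Fin m)

  goodTriple? : Decidable (λ (z : Triple) → Good (proj₁ z) (proj₂ z))
  goodTriple? (σ , bc) = good? σ bc

  triples : List Triple
  triples = filter goodTriple? (cartesianProduct (rejected N) pairs)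

  ∈-triples⁻ : ∀ {σ b c} → (σ , (b , c)) ∈ triples → σ ∈ rejected N × Good σ (b , c)
  ∈-triples⁻ z∈
    with z∈R×pairs , good ← ∈-filter⁻ goodTriple? {xs = cartesianProduct (rejected N) pairs} z∈ =
    proj₁ (∈-cartesianProduct⁻ (rejected N) pairs z∈R×pairs) , good

  encode : Triple → RankVec (suc m) × (Fin (suc m) × Fin (suc m))
  encode (σ , (b , c)) = front² σ b c , lookup σ (suc b) , lookup σ (suc c)

  codes : List (RankVec (suc m) × (Fin (suc m) × Fin (suc m)))
  codes = cartesianProduct (multiAccepted N) (cartesianProduct (allFin (suc m)) (allFin (suc m)))

  encode-∈ : ∀ {z} → z ∈ triples → encode z ∈ codes
  encode-∈ {σ , (b , c)} z∈ with σ∈R , good ← ∈-triples⁻ z∈ =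
    ∈-cartesianProduct⁺ (Rejected.GoodPair.front²-∈-multiAccepted σ∈R good)
                        (∈-cartesianProduct⁺ (∈-allFin _) (∈-allFin _))

  encode-injective : ∀ {z w} → z ∈ triples → w ∈ triples → encode z ≡ encode w → z ≡ w
  encode-injective {σ₁ , (b₁ , c₁)} {σ₂ , (b₂ , c₂)} z∈ w∈ eq
    with σ₁∈R , good₁ ← ∈-triples⁻ z∈ | σ₂∈R , good₂ ← ∈-triples⁻ w∈
    with refl ← front²-determines-c σ₁∈R (cong proj₁ eq)
    with refl ← front²-determines-b σ₁∈R good₁ σ₂∈R good₂ (cong proj₁ eq)
    = cong (_, (b₁ , c₁))
           (front²-cancel (cong (proj₁ ∘ proj₂) eq) (cong (proj₂ ∘ proj₂) eq) (cong proj₁ eq))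

  length-triples-≤ : length triples ≤ length (multiAccepted N) * (suc m * suc m)
  length-triples-≤ = begin
    length triples ≤⟨ injectiveOn⇒length≤ encode triples-unique encode-∈ encode-injective ⟩
    length codes   ≡⟨ length-cartesianProduct (multiAccepted N) _ ⟩
    length (multiAccepted N) * length (cartesianProduct (allFin (suc m)) (allFin (suc m)))
                   ≡⟨ cong (length (multiAccepted N) *_) (length-allFin² (suc m)) ⟩
    length (multiAccepted N) * (suc m * suc m) ∎
    where
    open ≤-Reasoning
    triples-unique = Unique.filter⁺ goodTriple? (Unique.cartesianProduct⁺ (rejected-unique N) pairs-unique)

  length-triples-≥ : length (rejected N) * (m * m) ≤ length triples + length (rejected N) * (m * k′ + m * k′)
  length-triples-≥ = length-filter-cartesianProduct-≥ goodTriple? (rejected N) pairs (m * m) (m * k′ + m * k′)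
    Rejected.length-good-pairs

  counting : length (rejected N) * (m * m) ≤
             length (multiAccepted N) * (suc m * suc m) + length (rejected N) * (m * k′ + m * k′)
  counting = ≤-trans length-triples-≥ (+-monoˡ-≤ _ length-triples-≤)

ratio-bound : ∀ m k′ R M → 10 * suc k′ ≤ suc m →
  R * (m * m) ≤ M * (suc m * suc m) + R * (m * k′ + m * k′) → 4 * R ≤ 5 * M
ratio-bound m k′ R M 10k≤n count = *-cancelʳ-≤ (4 * R) (5 * M) (suc m * suc m)
  (+-cancelʳ-≤ (R * (m * m)) _ _ (begin
    4 * R * (suc m * suc m) + R * (m * m)                           ≡⟨ e₁ R m ⟩
    5 * (R * (m * m)) + 8 * (R * m) + 4 * R                         ≤⟨ +-monoʳ-≤ (5 * (R * (m * m)) + 8 * (R * m)) 4R≤Rm ⟩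
    5 * (R * (m * m)) + 8 * (R * m) + R * m                         ≡⟨ e₂ R m ⟩
    5 * (R * (m * m)) + 9 * (R * m)                                 ≤⟨ +-monoˡ-≤ (9 * (R * m)) (*-monoʳ-≤ 5 count) ⟩
    5 * (M * (suc m * suc m) + R * (m * k′ + m * k′)) + 9 * (R * m) ≡⟨ e₃ R M m k′ ⟩
    5 * M * (suc m * suc m) + R * m * (10 * k′ + 9)                 ≤⟨ +-monoʳ-≤ (5 * M * (suc m * suc m))
                                                                                 (*-monoʳ-≤ (R * m) 10k′+9≤m) ⟩
    5 * M * (suc m * suc m) + R * m * m                             ≡⟨ cong (5 * M * (suc m * suc m) +_) (*-assoc R m m) ⟩
    5 * M * (suc m * suc m) + R * (m * m)                           ∎))
  where
  open ≤-Reasoning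
  10k′+9≤m : 10 * k′ + 9 ≤ m
  10k′+9≤m = ≤-pred (subst (_≤ suc m) (e₀ k′) 10k≤n)
    where
    e₀ : ∀ k′ → 10 * suc k′ ≡ suc (10 * k′ + 9)
    e₀ = solve-∀
  4R≤Rm : 4 * R ≤ R * m
  4R≤Rm = subst (_≤ R * m) (*-comm R 4)
    (*-monoʳ-≤ R (≤-trans (m≤m+n 4 5) (≤-trans (m≤n+m 9 (10 * k′)) 10k′+9≤m)))
  e₁ : ∀ R m → 4 * R * (suc m * suc m) + R * (m * m) ≡ 5 * (R * (m * m)) + 8 * (R * m) + 4 * R
  e₁ = solve-∀
  e₂ : ∀ R m → 5 * (R * (m * m)) + 8 * (R * m) + R * m ≡ 5 * (R * (m * m)) + 9 * (R * m)
  e₂ = solve-∀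
  e₃ : ∀ R M m k′ → 5 * (M * (suc m * suc m) + R * (m * k′ + m * k′)) + 9 * (R * m) ≡
                    5 * M * (suc m * suc m) + R * m * (10 * k′ + 9)
  e₃ = solve-∀

lemma4p9 : (m k : ℕ) (N : DNF (suc m)) →
    IsNormalized k N →
    IsWeakeningOfM1 N →
    10 * k ≤ suc m →
    4 * length (rejected N) ≤ 5 * length (multiAccepted N)
lemma4p9 m zero     N (() , _) _ _
lemma4p9 m (suc k′) N N-normal N-weakens 10k≤n =
  ratio-bound m k′ (length (rejected N)) (length (multiAccepted N)) 10k≤n (Counting.counting N N-normal N-weakens)
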